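{- Let $n\geq 4$ be an integer, $a=f_n^2$, $b=f_{n+1}^2$, $c=f_{n+2}^2$, let $\ell$ be the least non-negative integer with $\ell b\equiv c\pmod a$, $q=\left\lfloor \frac{a}{a-\ell}\right\rfloor$, $r=a-q(a-\ell)$, and let $u$ be the least non-negative integer with $u\equiv a-\ell \pmod r$. If $n$ is even, then \[ u=\begin{cases}1,& n=4,\\ 13,& n=6,\\ f_nf_{n-6}-4,& n\geq 8.\end{cases}\] If $n\geq 7$ is odd, then \[ u=\begin{cases}4,& n=7,\\ 55,& n=9,\\ f_nf_{n-9}-17,& n\geq 11.\end{cases}\]
   Context: The Fibonacci numbers are defined by $f_0=0$, $f_1=1$, $f_k=f_{k-1}+f_{k-2}$ for $k\geq 2$. -}

module Defs where

open import Data.Nat using (ℕ; zero; suc; _+_; _*_; _≤_; _<_)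
open import Data.Integer as ℤ using (ℤ; +_; _-_)
open import Data.Integer.Divisibility as ℤD using ()
open import Data.Product using (_×_)

fib : ℕ → ℕ
fib zero = 0
fib (suc zero) = 1
fib (suc (suc k)) = fib (suc k) + fib k

infix 4 _≡_[mod_]
_≡_[mod_] : ℕ → ℕ → ℕ → Set
x ≡ y [mod m ] = (+ m) ℤD.∣ ((+ x) - (+ y))

IsLeast : (ℕ → Set) → ℕ → Set
IsLeast P x = P x × (∀ y → P y → x ≤ y)

IsFloorDiv : ℕ → ℕ → ℕ → Set
IsFloorDiv q x d = (q * d ≤ x) × (x < suc q * d)

-- Write F = f_n. Since f_{n+2} = F + f_{n+1}, the congruence ℓ f_{n+1}² ≡ f_{n+2}² (mod F²) is solved by
-- ℓ = 1 + F f_{n-3} for even n and by ℓ = 1 + 2 F f_{n-2} for odd n; this is d'Ocagne's identity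
-- f_{n-3} f_{n+1} = f_{n-2} F + 2, resp. f_{n-2} f_{n+1} = f_{n-1} F + 1. It is the least solution because
-- f_{n-1} f_{n+1} = F² ± 1 (Cassini) makes f_{n+1}² invertible modulo F². For even n one then finds
-- a - ℓ = 3ℓ + (F f_{n-6} - 4), so q = 1, r = ℓ and u = F f_{n-6} - 4; for odd n, a - ℓ = F f_{n-3} - 1,
-- q = 4, r = F f_{n-6} + 4 and u = F f_{n-9} - 17. Both rest on f_k = 4 f_{k-3} + f_{k-6}.

module Submission where

open import Defs
open import Data.Nat using (ℕ; zero; suc; _+_; _*_; _∸_; _≤_; _<_; s≤s; z≤n; NonZero)
open import Data.Nat.Properties
open import Data.Nat.Divisibility using (_∣_; divides; >⇒∤)
open import Data.Nat.Tactic.RingSolver using (solve-∀; solve)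
open import Data.Integer as ℤ using (ℤ; +_; _-_)
import Data.Integer.Properties as ℤₚ
import Data.Integer.Divisibility.Signed as ℤ∣
import Data.Integer.Tactic.RingSolver as ℤ-Solver
open import Data.List using (_∷_; [])
open import Data.Product using (_×_; _,_; ∃-syntax)
open import Data.Sum using (_⊎_; inj₁; inj₂)
open import Data.Unit using (tt)
open import Relation.Nullary using (¬_; contradiction)
open import Relation.Binary.PropositionalEquality

∣∧<⇒≡0 : ∀ {m n} → m ∣ n → n < m → n ≡ 0
∣∧<⇒≡0 {n = zero}  _   _   = refl
∣∧<⇒≡0 {n = suc _} m∣n n<m = contradiction m∣n (>⇒∤ n<m)

m<o+n*m : ∀ o {m n} .{{_ : NonZero m}} → 1 < n → m < o + n * m
m<o+n*m o {m} {n} 1<n = <-≤-trans (m<m*n m n 1<n) (≤-trans (≤-reflexive (*-comm m n)) (m≤n+m (n * m) o))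

pos-∸ : ∀ {m n} → n ≤ m → + (m ∸ n) ≡ + m - + n
pos-∸ {m} {n} n≤m = trans (sym (ℤₚ.⊖-≥ n≤m)) (sym (ℤₚ.m-n≡m⊖n m n))

mod-intro : ∀ {x y m} i j → x + i * m ≡ y + j * m → x ≡ y [mod m ]
mod-intro {x} {y} {m} i j eq = ℤ∣.∣⇒∣ᵤ (ℤ∣.divides (+ j - + i)
  (shift (+ x) (+ y) (+ i) (+ j) (+ m) (trans (sym (embed x i m)) (trans (cong +_ eq) (embed y j m)))))
  where
  open ≡-Reasoning
  embed : ∀ a b c → + (a + b * c) ≡ + a ℤ.+ + b ℤ.* + c
  embed a b c = trans (ℤₚ.pos-+ a (b * c)) (cong (λ z → + a ℤ.+ z) (ℤₚ.pos-* b c))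
  shift : ∀ X Y I J M → X ℤ.+ I ℤ.* M ≡ Y ℤ.+ J ℤ.* M → X - Y ≡ (J - I) ℤ.* M
  shift X Y I J M h = begin
    X - Y                             ≡⟨ ℤ-Solver.solve (X ∷ Y ∷ I ∷ M ∷ []) ⟩
    (X ℤ.+ I ℤ.* M) - (Y ℤ.+ I ℤ.* M) ≡⟨ cong (_- (Y ℤ.+ I ℤ.* M)) h ⟩
    (Y ℤ.+ J ℤ.* M) - (Y ℤ.+ I ℤ.* M) ≡⟨ ℤ-Solver.solve (Y ∷ I ∷ J ∷ M ∷ []) ⟩
    (J - I) ℤ.* M                     ∎

mod-sym : ∀ {x y m} → x ≡ y [mod m ] → y ≡ x [mod m ]
mod-sym {x} {y} {m} = subst (m ∣_) (ℤₚ.∣i-j∣≡∣j-i∣ (+ x) (+ y))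

mod-trans : ∀ {x y z m} → x ≡ y [mod m ] → y ≡ z [mod m ] → x ≡ z [mod m ]
mod-trans {x} {y} {z} {m} x≡y y≡z = ℤ∣.∣⇒∣ᵤ (subst (+ m ℤ∣.∣_) (telescope (+ x) (+ y) (+ z))
  (ℤ∣.∣m∣n⇒∣m+n (ℤ∣.∣ᵤ⇒∣ {+ m} {+ x - + y} x≡y)
                (ℤ∣.∣ᵤ⇒∣ {+ m} {+ y - + z} y≡z)))
  where
  telescope : ∀ X Y Z → (X - Y) ℤ.+ (Y - Z) ≡ X - Z
  telescope = ℤ-Solver.solve-∀

mod-bounded⇒≡ : ∀ {x y m} → x ≡ y [mod m ] → y ≤ x → x < m → x ≡ y
mod-bounded⇒≡ {x} {y} {m} x≡y y≤x x<m =
  ≤-antisym (m∸n≡0⇒m≤n (∣∧<⇒≡0 m∣x∸y (≤-<-trans (m∸n≤m x y) x<m))) y≤x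
  where
  m∣x∸y : m ∣ x ∸ y
  m∣x∸y = subst (m ∣_) (cong ℤ.∣_∣ (trans (ℤₚ.m-n≡m⊖n x y) (ℤₚ.⊖-≥ y≤x))) x≡y

*-cancelʳ-mod : ∀ {a b k x y} → k * b ≡ 1 [mod a ] → x * b ≡ y * b [mod a ] → x ≡ y [mod a ]
*-cancelʳ-mod {a} {b} {k} {x} {y} kb≡1 xb≡yb = ℤ∣.∣⇒∣ᵤ (subst (+ a ℤ∣.∣_) combination
  (ℤ∣.∣m∣n⇒∣m-n (ℤ∣.∣n⇒∣m*n (+ k) (ℤ∣.∣ᵤ⇒∣ {+ a} xb≡yb))
                (ℤ∣.∣n⇒∣m*n (+ x - + y) (ℤ∣.∣ᵤ⇒∣ {+ a} kb≡1))))
  where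
  expand : ∀ {K B X Y XB YB KB} → XB ≡ X ℤ.* B → YB ≡ Y ℤ.* B → KB ≡ K ℤ.* B →
             K ℤ.* (XB - YB) - (X - Y) ℤ.* (KB - + 1) ≡ X - Y
  expand {K} {B} {X} {Y} refl refl refl = ℤ-Solver.solve (K ∷ B ∷ X ∷ Y ∷ [])
  combination : + k ℤ.* (+ (x * b) - + (y * b)) - (+ x - + y) ℤ.* (+ (k * b) - + 1) ≡ + x - + y
  combination = expand {+ k} {+ b} {+ x} {+ y} (ℤₚ.pos-* x b) (ℤₚ.pos-* y b) (ℤₚ.pos-* k b)

square≡1 : ∀ {a g} → g ≡ a + 1 ⊎ g + 1 ≡ a → g * g ≡ 1 [mod a ]
square≡1 {a} (inj₁ refl) = mod-intro 0 (a + 2) (expand a)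
  where
  expand : ∀ a → (a + 1) * (a + 1) + 0 * a ≡ 1 + (a + 2) * a
  expand = solve-∀
square≡1 {g = g} (inj₂ refl) = mod-intro {g * g} 2 (g + 1) (expand g)
  where
  expand : ∀ g → g * g + 2 * (g + 1) ≡ 1 + (g + 1) * (g + 1)
  expand = solve-∀

square-inverse : ∀ {a} p B → p * B ≡ a + 1 ⊎ p * B + 1 ≡ a → (p * p) * (B * B) ≡ 1 [mod a ]
square-inverse {a} p B pB≡±1 = subst (_≡ 1 [mod a ]) (regroup p B) (square≡1 pB≡±1)
  where
  regroup : ∀ p B → (p * B) * (p * B) ≡ (p * p) * (B * B)
  regroup = solve-∀

solution-mod-square : ∀ F B {C} x y → C ≡ F + B → x * B ≡ y * F + 2 →
                      (1 + F * x) * (B * B) ≡ C * C [mod F * F ]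
solution-mod-square F B x y refl xB≡yF+2 = mod-intro 1 (B * y) (begin
  (1 + F * x) * (B * B) + 1 * (F * F) ≡⟨ solve (F ∷ B ∷ x ∷ []) ⟩
  B * B + F * B * (x * B) + F * F     ≡⟨ cong (λ z → B * B + F * B * z + F * F) xB≡yF+2 ⟩
  B * B + F * B * (y * F + 2) + F * F ≡⟨ solve (F ∷ B ∷ y ∷ []) ⟩
  (F + B) * (F + B) + B * y * (F * F) ∎)
  where open ≡-Reasoning

least-residue : ∀ {d r u U} → IsLeast (λ x → x ≡ d [mod r ]) u → U ≡ d [mod r ] → U < r → u ≡ U
least-residue {d} {r} {u} {U} (u≡d , least) U≡d U<r =
  sym (mod-bounded⇒≡ {U} {u} {r} U≡u (least U U≡d) U<r)
  where
  U≡u : U ≡ u [mod r ]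
  U≡u = mod-trans {U} {d} {u} U≡d (mod-sym {u} {d} u≡d)

least-solution : ∀ {a b c k ℓ L} → k * b ≡ 1 [mod a ] → IsLeast (λ x → x * b ≡ c [mod a ]) ℓ →
                 L * b ≡ c [mod a ] → L < a → ℓ ≡ L
least-solution {a} {b} {c} {k} {ℓ} {L} kb≡1 (ℓb≡c , least) Lb≡c L<a =
  sym (mod-bounded⇒≡ {L} {ℓ} {a} L≡ℓ (least L Lb≡c) L<a)
  where
  L≡ℓ : L ≡ ℓ [mod a ]
  L≡ℓ = *-cancelʳ-mod {a} {b} {k} {L} {ℓ} kb≡1
          (mod-trans {L * b} {c} {ℓ * b} Lb≡c (mod-sym {ℓ * b} {c} ℓb≡c))

floor-intro : ∀ {x d Q r} → Q * d + r ≡ x → r < d → IsFloorDiv Q x d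
floor-intro {d = d} {Q} {r} refl r<d =
  m≤m+n (Q * d) r , <-≤-trans (+-monoʳ-< (Q * d) r<d) (≤-reflexive (+-comm (Q * d) d))

floor-unique : ∀ {q Q x d} → IsFloorDiv q x d → IsFloorDiv Q x d → q ≡ Q
floor-unique (qd≤x , x<[1+q]d) (Qd≤x , x<[1+Q]d) =
  ≤-antisym (below qd≤x x<[1+Q]d) (below Qd≤x x<[1+q]d)
  where
  below : ∀ {i j x d} → i * d ≤ x → x < suc j * d → i ≤ j
  below {i} {j} {d = d} id≤x x<[1+j]d = ≤-pred (*-cancelʳ-< d i (suc j) (≤-<-trans id≤x x<[1+j]d))

record Construction (a b c ℓ q u : ℕ) : Set where
  constructor construction
  field
    ℓ-least : IsLeast (λ x → x * b ≡ c [mod a ]) ℓ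
    q-floor : IsFloorDiv q a (a ∸ ℓ)
    u-least : IsLeast (λ x → x ≡ a ∸ ℓ [mod a ∸ q * (a ∸ ℓ) ]) u

-- Candidate values L, Q, d = a ∸ L and r = a ∸ Q * d for ℓ, q, a ∸ ℓ and a ∸ q * (a ∸ ℓ),
-- with d = t * r + U, and an inverse k of b modulo a, which makes L the least solution of x * b ≡ c.
record Certificate (a b c U : ℕ) : Set where
  field
    k L d Q r t : ℕ
    inverse  : k * b ≡ 1 [mod a ]
    solution : L * b ≡ c [mod a ]
    L+d≡a    : L + d ≡ a
    Qd+r≡a   : Q * d + r ≡ a
    r<d      : r < d
    U+tr≡d   : U + t * r ≡ d
    U<r      : U < r

certificate⇒u : ∀ {a b c U ℓ q u} → Certificate a b c U → Construction a b c ℓ q u → u ≡ U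
certificate⇒u {a} {b} {c} {U} {ℓ} {q} {u} cert (construction ℓ-least q-floor u-least) =
  least-residue {d} {r} u-least′ (mod-intro t 0 (trans U+tr≡d (sym (+-identityʳ d)))) U<r
  where
  open Certificate cert
  ℓ≡L : ℓ ≡ L
  ℓ≡L = least-solution {a} {b} {c} {k} inverse ℓ-least solution
          (subst (L <_) L+d≡a (m<m+n L (≤-<-trans z≤n r<d)))
  a∸ℓ≡d : a ∸ ℓ ≡ d
  a∸ℓ≡d = trans (cong₂ _∸_ (sym L+d≡a) ℓ≡L) (m+n∸m≡n L d)
  q≡Q : q ≡ Q
  q≡Q = floor-unique (subst (IsFloorDiv q a) a∸ℓ≡d q-floor) (floor-intro {Q = Q} Qd+r≡a r<d)
  a∸q[a∸ℓ]≡r : a ∸ q * (a ∸ ℓ) ≡ r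
  a∸q[a∸ℓ]≡r = begin
    a ∸ q * (a ∸ ℓ)   ≡⟨ cong₂ (λ x y → a ∸ x * y) q≡Q a∸ℓ≡d ⟩
    a ∸ Q * d         ≡⟨ cong (_∸ Q * d) (sym Qd+r≡a) ⟩
    Q * d + r ∸ Q * d ≡⟨ m+n∸m≡n (Q * d) r ⟩
    r                 ∎
    where open ≡-Reasoning
  u-least′ : IsLeast (λ x → x ≡ d [mod r ]) u
  u-least′ = subst₂ (λ d′ r′ → IsLeast (λ x → x ≡ d′ [mod r′ ]) u) a∸ℓ≡d a∸q[a∸ℓ]≡r u-least

fib-mono-suc : ∀ k → fib k ≤ fib (suc k)
fib-mono-suc zero    = z≤n
fib-mono-suc (suc k) = m≤m+n (fib (suc k)) (fib k)

fib-mono : ∀ {m n} → m ≤ n → fib m ≤ fib n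
fib-mono {n = zero} z≤n = ≤-refl
fib-mono {m} {suc n} m≤1+n with m≤n⇒m<n∨m≡n m≤1+n
... | inj₁ m<1+n = ≤-trans (fib-mono (≤-pred m<1+n)) (fib-mono-suc n)
... | inj₂ refl  = ≤-refl

fib-+1 : ∀ n → fib (n + 1) ≡ fib (suc n)
fib-+1 n = cong fib (+-comm n 1)

fib-+2 : ∀ n → fib (n + 2) ≡ fib n + fib (n + 1)
fib-+2 n = trans (cong fib (+-comm n 2))
                 (trans (+-comm (fib (suc n)) (fib n)) (cong (λ z → fib n + z) (sym (fib-+1 n))))

fib-+3 : ∀ k → fib (3 + k) ≡ 2 * fib (1 + k) + fib k
fib-+3 k = expand (fib k) (fib (suc k))
  where
  expand : ∀ x y → (y + x) + y ≡ 2 * y + x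
  expand = solve-∀

fib-+6 : ∀ k → fib (6 + k) ≡ 4 * fib (3 + k) + fib k
fib-+6 k = expand (fib k) (fib (suc k))
  where
  expand : ∀ x y → let f₂ = y + x; f₃ = f₂ + y; f₄ = f₃ + f₂; f₅ = f₄ + f₃ in f₅ + f₄ ≡ 4 * f₃ + x
  expand = solve-∀

cassini-step : ∀ k {s t} → fib k * fib (2 + k) + s ≡ fib (1 + k) * fib (1 + k) + t →
               fib (1 + k) * fib (3 + k) + t ≡ fib (2 + k) * fib (2 + k) + s
cassini-step k {s} {t} = step (fib k) (fib (suc k))
  where
  step : ∀ x y → x * (y + x) + s ≡ y * y + t → y * ((y + x) + y) + t ≡ (y + x) * (y + x) + s
  step x y h = +-cancelʳ-≡ (x * (y + x) + s) _ _ (begin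
    y * ((y + x) + y) + t + (x * (y + x) + s) ≡⟨ solve (x ∷ y ∷ s ∷ t ∷ []) ⟩
    (y + x) * (y + x) + s + (y * y + t)       ≡⟨ cong (λ z → (y + x) * (y + x) + s + z) (sym h) ⟩
    (y + x) * (y + x) + s + (x * (y + x) + s) ∎)
    where open ≡-Reasoning

cassini-even : ∀ j → fib (j * 2) * fib (2 + j * 2) + 1 ≡ fib (1 + j * 2) * fib (1 + j * 2)
cassini-odd  : ∀ j → fib (1 + j * 2) * fib (3 + j * 2) ≡ fib (2 + j * 2) * fib (2 + j * 2) + 1

cassini-even zero    = refl
cassini-even (suc j) =
  trans (cassini-step (1 + j * 2) (trans (+-identityʳ _) (cassini-odd j))) (+-identityʳ _)
cassini-odd j =
  trans (sym (+-identityʳ _)) (cassini-step (j * 2) (trans (cassini-even j) (sym (+-identityʳ _))))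

cassini⇒dOcagne : ∀ k → fib k * fib (2 + k) ≡ fib (1 + k) * fib (1 + k) + 1 →
         ∀ j → fib k * fib (suc j + k) ≡ fib (1 + k) * fib (j + k) + fib j
cassini⇒dOcagne k _ zero                = trans (*-comm (fib k) (fib (suc k))) (sym (+-identityʳ _))
cassini⇒dOcagne _ cassini (suc zero)    = cassini
cassini⇒dOcagne k cassini (suc (suc j)) = begin
  fib k * (fib (suc (suc j) + k) + fib (suc j + k))
    ≡⟨ *-distribˡ-+ (fib k) _ _ ⟩
  fib k * fib (suc (suc j) + k) + fib k * fib (suc j + k)
    ≡⟨ cong₂ _+_ (cassini⇒dOcagne k cassini (suc j)) (cassini⇒dOcagne k cassini j) ⟩
  (fib (1 + k) * fib (suc j + k) + fib (suc j)) + (fib (1 + k) * fib (j + k) + fib j)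
    ≡⟨ regroup (fib (1 + k)) (fib (suc j + k)) (fib (j + k)) (fib (suc j)) (fib j) ⟩
  fib (1 + k) * (fib (suc j + k) + fib (j + k)) + (fib (suc j) + fib j) ∎
  where
  open ≡-Reasoning
  regroup : ∀ y a b e f → (y * a + e) + (y * b + f) ≡ y * (a + b) + (e + f)
  regroup = solve-∀

even-L+d≡a : ∀ F x w U → F ≡ 4 * x + w → U + 4 ≡ F * w →
             (1 + F * x) + (U + 3 * (1 + F * x)) ≡ F * F
even-L+d≡a F x w U F≡4x+w U+4≡Fw = begin
  (1 + F * x) + (U + 3 * (1 + F * x)) ≡⟨ solve (F ∷ x ∷ U ∷ []) ⟩
  (U + 4) + F * (4 * x)               ≡⟨ cong (_+ F * (4 * x)) U+4≡Fw ⟩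
  F * w + F * (4 * x)                 ≡⟨ solve (F ∷ x ∷ w ∷ []) ⟩
  F * (4 * x + w)                     ≡⟨ cong (F *_) (sym F≡4x+w) ⟩
  F * F                               ∎
  where open ≡-Reasoning

odd-L+d≡a : ∀ F x {g} s v U → F ≡ 2 * x + g → g ≡ 4 * s + v → U + 17 ≡ F * v →
            (1 + F * (2 * x)) + (U + 4 * (4 + F * s)) ≡ F * F
odd-L+d≡a F x s v U F≡2x+g refl U+17≡Fv = begin
  (1 + F * (2 * x)) + (U + 4 * (4 + F * s)) ≡⟨ solve (F ∷ x ∷ s ∷ U ∷ []) ⟩
  (U + 17) + F * (2 * x + 4 * s)            ≡⟨ cong (_+ F * (2 * x + 4 * s)) U+17≡Fv ⟩
  F * v + F * (2 * x + 4 * s)               ≡⟨ solve (F ∷ x ∷ s ∷ v ∷ []) ⟩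
  F * (2 * x + (4 * s + v))                 ≡⟨ cong (F *_) (sym F≡2x+g) ⟩
  F * F                                     ∎
  where open ≡-Reasoning

odd-4d+r≡a : ∀ F {g} s v U → F ≡ 4 * g + s → g ≡ 4 * s + v → U + 17 ≡ F * v →
             4 * (U + 4 * (4 + F * s)) + (4 + F * s) ≡ F * F
odd-4d+r≡a F s v U F≡4g+s refl U+17≡Fv = begin
  4 * (U + 4 * (4 + F * s)) + (4 + F * s) ≡⟨ solve (F ∷ s ∷ U ∷ []) ⟩
  4 * (U + 17) + 17 * (F * s)             ≡⟨ cong (λ z → 4 * z + 17 * (F * s)) U+17≡Fv ⟩
  4 * (F * v) + 17 * (F * s)              ≡⟨ solve (F ∷ s ∷ v ∷ []) ⟩
  F * (4 * (4 * s + v) + s)               ≡⟨ cong (F *_) (sym F≡4g+s) ⟩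
  F * F                                   ∎
  where open ≡-Reasoning

FibConstruction : ℕ → ℕ → ℕ → ℕ → Set
FibConstruction n = Construction (fib n * fib n) (fib (n + 1) * fib (n + 1)) (fib (n + 2) * fib (n + 2))

FibCertificate : ℕ → ℕ → Set
FibCertificate n = Certificate (fib n * fib n) (fib (n + 1) * fib (n + 1)) (fib (n + 2) * fib (n + 2))

even-case : ∀ i {ℓ q u} → FibConstruction (8 + i * 2) ℓ q u →
            + u ≡ + (fib (8 + i * 2) * fib (2 + i * 2)) - + 4
even-case i steps = trans (cong +_ (certificate⇒u certificate steps)) (pos-∸ 4≤Fw)
  where
  m n F x y w U L : ℕ
  m = i * 2
  n = 8 + m
  F = fib n
  x = fib (5 + m)
  y = fib (6 + m)
  w = fib (2 + m)
  U = F * w ∸ 4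
  L = 1 + F * x

  4≤Fw : 4 ≤ F * w
  4≤Fw = ≤-trans (m≤m+n 4 17) (*-mono-≤ (fib-mono (m≤m+n 8 m)) (fib-mono (m≤m+n 2 m)))

  xB≡yF+2 : x * fib (n + 1) ≡ y * F + 2
  xB≡yF+2 = subst (λ B → x * B ≡ y * F + 2) (sym (fib-+1 n))
                  (cassini⇒dOcagne (5 + m) (cassini-odd (2 + i)) 3)

  pB≡a+1 : fib (7 + m) * fib (n + 1) ≡ F * F + 1
  pB≡a+1 = subst (λ B → fib (7 + m) * B ≡ F * F + 1) (sym (fib-+1 n)) (cassini-odd (3 + i))

  L+d≡a : L + (U + 3 * L) ≡ F * F
  L+d≡a = even-L+d≡a F x w U (fib-+6 (2 + m)) (m∸n+n≡m 4≤Fw)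

  certificate : FibCertificate n U
  certificate = record
    { k = fib (7 + m) * fib (7 + m) ; L = L ; d = U + 3 * L ; Q = 1 ; r = L ; t = 3
    ; inverse  = square-inverse (fib (7 + m)) (fib (n + 1)) (inj₁ pB≡a+1)
    ; solution = solution-mod-square F (fib (n + 1)) x y (fib-+2 n) xB≡yF+2
    ; L+d≡a    = L+d≡a
    ; Qd+r≡a   = trans (cong (_+ L) (*-identityˡ _)) (trans (+-comm _ L) L+d≡a)
    ; r<d      = m<o+n*m U {L} {3} (s≤s (s≤s z≤n))
    ; U+tr≡d   = refl
    ; U<r      = s≤s (≤-trans (m∸n≤m (F * w) 4) (*-monoʳ-≤ F (fib-mono (m≤n+m (2 + m) 3))))
    }

odd-case : ∀ i {ℓ q u} → FibConstruction (11 + i * 2) ℓ q u →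
           + u ≡ + (fib (11 + i * 2) * fib (2 + i * 2)) - + 17
odd-case i steps = trans (cong +_ (certificate⇒u certificate steps)) (pos-∸ 17≤Fv)
  where
  m n F x y s v U r : ℕ
  m = i * 2
  n = 11 + m
  F = fib n
  x = fib (9 + m)
  y = fib (10 + m)
  s = fib (5 + m)
  v = fib (2 + m)
  U = F * v ∸ 17
  r = 4 + F * s

  17≤Fv : 17 ≤ F * v
  17≤Fv = ≤-trans (m≤m+n 17 72) (*-mono-≤ (fib-mono (m≤m+n 11 m)) (fib-mono (m≤m+n 2 m)))

  xB≡yF+1 : x * fib (n + 1) ≡ y * F + 1
  xB≡yF+1 = subst (λ B → x * B ≡ y * F + 1) (sym (fib-+1 n))
                  (cassini⇒dOcagne (9 + m) (cassini-odd (4 + i)) 2)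

  2xB≡2yF+2 : (2 * x) * fib (n + 1) ≡ (2 * y) * F + 2
  2xB≡2yF+2 = begin
    (2 * x) * fib (n + 1) ≡⟨ *-assoc 2 x _ ⟩
    2 * (x * fib (n + 1)) ≡⟨ cong (2 *_) xB≡yF+1 ⟩
    2 * (y * F + 1)       ≡⟨ *-distribˡ-+ 2 (y * F) 1 ⟩
    2 * (y * F) + 2       ≡⟨ cong (_+ 2) (sym (*-assoc 2 y F)) ⟩
    (2 * y) * F + 2       ∎
    where open ≡-Reasoning

  yB+1≡a : y * fib (n + 1) + 1 ≡ F * F
  yB+1≡a = subst (λ B → y * B + 1 ≡ F * F) (sym (fib-+1 n)) (cassini-even (5 + i))

  certificate : FibCertificate n U
  certificate = record
    { k = y * y ; L = 1 + F * (2 * x) ; d = U + 4 * r ; Q = 4 ; r = r ; t = 4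
    ; inverse  = square-inverse y (fib (n + 1)) (inj₂ yB+1≡a)
    ; solution = solution-mod-square F (fib (n + 1)) (2 * x) (2 * y) (fib-+2 n) 2xB≡2yF+2
    ; L+d≡a    = odd-L+d≡a F x s v U (fib-+3 (8 + m)) (fib-+6 (2 + m)) (m∸n+n≡m 17≤Fv)
    ; Qd+r≡a   = odd-4d+r≡a F s v U (fib-+6 (5 + m)) (fib-+6 (2 + m)) (m∸n+n≡m 17≤Fv)
    ; r<d      = m<o+n*m U {r} {4} (s≤s (s≤s z≤n))
    ; U+tr≡d   = refl
    ; U<r      = ≤-<-trans (≤-trans (m∸n≤m (F * v) 17) (*-monoʳ-≤ F (fib-mono (m≤n+m (2 + m) 3))))
                           (m<n+m (F * s) (s≤s z≤n))
    }

certificate₄ : FibCertificate 4 1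
certificate₄ = record
  { k = 4 ; L = 4 ; d = 5 ; Q = 1 ; r = 4 ; t = 1
  ; inverse = divides 11 refl ; solution = divides 4 refl
  ; L+d≡a = refl ; Qd+r≡a = refl ; r<d = ≤ᵇ⇒≤ _ _ tt ; U+tr≡d = refl ; U<r = ≤ᵇ⇒≤ _ _ tt }

certificate₆ : FibCertificate 6 13
certificate₆ = record
  { k = 25 ; L = 17 ; d = 47 ; Q = 1 ; r = 17 ; t = 2
  ; inverse = divides 66 refl ; solution = divides 38 refl
  ; L+d≡a = refl ; Qd+r≡a = refl ; r<d = ≤ᵇ⇒≤ _ _ tt ; U+tr≡d = refl ; U<r = ≤ᵇ⇒≤ _ _ tt }

certificate₇ : FibCertificate 7 4
certificate₇ = record
  { k = 64 ; L = 131 ; d = 38 ; Q = 4 ; r = 17 ; t = 2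
  ; inverse = divides 167 refl ; solution = divides 335 refl
  ; L+d≡a = refl ; Qd+r≡a = refl ; r<d = ≤ᵇ⇒≤ _ _ tt ; U+tr≡d = refl ; U<r = ≤ᵇ⇒≤ _ _ tt }

certificate₉ : FibCertificate 9 55
certificate₉ = record
  { k = 441 ; L = 885 ; d = 271 ; Q = 4 ; r = 72 ; t = 3
  ; inverse = divides 1154 refl ; solution = divides 2309 refl
  ; L+d≡a = refl ; Qd+r≡a = refl ; r<d = ≤ᵇ⇒≤ _ _ tt ; U+tr≡d = refl ; U<r = ≤ᵇ⇒≤ _ _ tt }

even⊎odd : ∀ n → 2 ∣ n ⊎ ∃[ j ] n ≡ 1 + j * 2
even⊎odd zero = inj₁ (divides 0 refl)
even⊎odd (suc n) with even⊎odd n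
... | inj₁ (divides j refl) = inj₂ (j , refl)
... | inj₂ (j , refl)       = inj₁ (divides (suc j) refl)

even-branch : ∀ {n ℓ q u} → 2 ∣ n → 8 ≤ n → FibConstruction n ℓ q u →
              + u ≡ + (fib n * fib (n ∸ 6)) - + 4
even-branch (divides j refl) 8≤n with m≤n⇒∃[o]m+o≡n (*-cancelʳ-≤ 4 j 2 8≤n)
... | i , refl = even-case i

odd-branch : ∀ {n ℓ q u} → ¬ 2 ∣ n → 11 ≤ n → FibConstruction n ℓ q u →
             + u ≡ + (fib n * fib (n ∸ 9)) - + 17
odd-branch {n} 2∤n 11≤n with even⊎odd n
... | inj₁ 2∣n = contradiction 2∣n 2∤n
... | inj₂ (j , refl) with m≤n⇒∃[o]m+o≡n (*-cancelʳ-≤ 5 j 2 (≤-pred 11≤n))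
...   | i , refl = odd-case i

lemma4p15 : (n : ℕ) → 4 ≤ n →
    (ℓ q u : ℕ) →
    IsLeast (λ x → x * (fib (n + 1) * fib (n + 1)) ≡ fib (n + 2) * fib (n + 2) [mod fib n * fib n ]) ℓ →
    IsFloorDiv q (fib n * fib n) (fib n * fib n ∸ ℓ) →
    IsLeast (λ x → x ≡ fib n * fib n ∸ ℓ [mod fib n * fib n ∸ q * (fib n * fib n ∸ ℓ) ]) u →
    ((n ≡ 4 → u ≡ 1)
     × (n ≡ 6 → u ≡ 13)
     × (2 ∣ n → 8 ≤ n → + u ≡ + (fib n * fib (n ∸ 6)) - + 4)
     × (n ≡ 7 → u ≡ 4)
     × (n ≡ 9 → u ≡ 55)
     × (¬ (2 ∣ n) → 11 ≤ n → + u ≡ + (fib n * fib (n ∸ 9)) - + 17))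
lemma4p15 n _ ℓ q u ℓ-least q-floor u-least =
    (λ { refl → certificate⇒u certificate₄ steps })
  , (λ { refl → certificate⇒u certificate₆ steps })
  , (λ 2∣n 8≤n → even-branch 2∣n 8≤n steps)
  , (λ { refl → certificate⇒u certificate₇ steps })
  , (λ { refl → certificate⇒u certificate₉ steps })
  , (λ 2∤n 11≤n → odd-branch 2∤n 11≤n steps)
  where
  steps : FibConstruction n ℓ q u
  steps = construction ℓ-least q-floor u-least
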